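{- For every integer $n\geq 0$ and every word $w=a_1\cdots a_n\in\mathfrak{h}^1$ ($a_i\in A$) of length $n$, \[S^t(w)=\sum_{r\in R_n}t^{\sigma(r)}\mathrm{Con}_r(w).\]
   Context: Let $\mathfrak{A}$ be a commutative $\mathbb{Q}$-algebra, $A$ a set of letters, $\mathfrak{h}^1=\mathfrak{A}\langle A\rangle$ the non-commutative polynomial algebra over $\mathfrak{A}$ on $A$ (words are monic monomials; the empty word is $1$), and $\mathfrak{z}$ the $\mathfrak{A}$-submodule of $\mathfrak{h}^1$ spanned by $A$. Assume $\mathfrak{z}$ carries a commutative, associative, not necessarily unital $\mathfrak{A}$-algebra structure with product $\circ$. Extend $\circ$ to an action of $\mathfrak{z}$ on $\mathfrak{h}^1$ by $a\circ 1=0$, $a\circ(bw)=(a\circ b)w$ for $a,b\in A$ and words $w$, and $\mathfrak{A}$-linearity. Let $t$ be an indeterminate and let $S^t$ be the $\mathfrak{A}[t]$-linear operator on $\mathfrak{h}^1[t]$ defined by $S^t(1)=1$ and $S^t(aw)=aS^t(w)+t\,a\circ S^t(w)$ for $a\in A$ and words $w$. For $n\geq 0$, $R_n$ denotes the set of strictly increasing subsequences $r=(r_0,\ldots,r_s)$ of $(0,1,\ldots,n)$ with $r_0=0$ and $r_s=n$; for such $r$ set $\sigma(r)=n-s$, and for a word $w=a_1\cdots a_n$ define $\mathrm{Con}_r(w)=b_1\cdots b_s$ where $b_i=a_{r_{i-1}+1}\circ\cdots\circ a_{r_i}$ for $i=1,\ldots,s$ (so $\mathrm{Con}_r(w)=1$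 when $n=0$). -}

module Defs where

open import Level using (Level; _⊔_)
open import Data.Bool using (Bool; _∧_)
open import Data.Nat using (ℕ; zero; suc; _∸_; _≡ᵇ_)
open import Data.Product using (_×_; _,_)
open import Data.List using (List; []; _∷_; _++_; map; concatMap; filterᵇ; upTo; length; take; drop; last)
open import Data.Maybe using (Maybe; just; nothing)
open import Algebra.Bundles using (CommutativeRing)
open import Algebra.Morphism.Structures using (IsRingHomomorphism)
open import Data.Rational using (ℚ)
import Data.Rational.Properties as ℚP

IsℚAlgebra : ∀ {c ℓ} (R : CommutativeRing c ℓ) → Set (c ⊔ ℓ)
IsℚAlgebra R = Σℚ
  where
  open CommutativeRing R using (rawRing; Carrier)
  open import Data.Product using (Σ)
  Σℚ = Σ (ℚ → Carrier) (IsRingHomomorphism ℚP.+-*-rawRing rawRing)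

-- All (order-preserving) sublists; sublists of (0,1,…,n) are exactly the
-- strictly increasing subsequences of (0,1,…,n).
sublists : ∀ {a} {X : Set a} → List X → List (List X)
sublists []       = [] ∷ []
sublists (x ∷ xs) = map (x ∷_) (sublists xs) ++ sublists xs

validR : ℕ → List ℕ → Bool
validR n []      = Bool.false where import Data.Bool as Bool
validR n (r₀ ∷ rs) = (r₀ ≡ᵇ 0) ∧ lastIs (r₀ ∷ rs)
  where
  lastIs : List ℕ → Bool
  lastIs l with last l
  ... | just x  = x ≡ᵇ n
  ... | nothing = Data.Bool.false where import Data.Bool

R : ℕ → List (List ℕ)
R n = filterᵇ (validR n) (sublists (upTo (suc n)))

sOf : List ℕ → ℕ
sOf r = length r ∸ 1

σ : ℕ → List ℕ → ℕ
σ n r = n ∸ sOf r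

blocks : ∀ {a} {A : Set a} → List ℕ → List A → List (List A)
blocks (p ∷ q ∷ rest) w = take (q ∸ p) (drop p w) ∷ blocks (q ∷ rest) w
blocks _              w = []

-- The algebraic setting.
--   𝔄   : commutative ring R (ℚ-algebra structure supplied separately)
--   A   : set of letters
--   mul : a ∘ b ∈ 𝔷 for letters a, b (the product on 𝔷 on basis elements)

module Setting {c ℓ a} (𝔄 : CommutativeRing c ℓ) (A : Set a)
               (mul : A → A → List (CommutativeRing.Carrier 𝔄 × A)) where

  open CommutativeRing 𝔄

  Word : Set a
  Word = List A

  -- Elements of 𝔷 as formal 𝔄-linear combinations Σ cᵢ aᵢ of letters.
  Z : Set (c ⊔ a)
  Z = List (Carrier × A)

  -- Elements of 𝔥¹[t] as formal combinations Σ cᵢ t^{kᵢ} wᵢ.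
  H : Set (c ⊔ a)
  H = List (Carrier × ℕ × Word)

  evalZ : (A → Carrier) → Z → Carrier
  evalZ g []             = 0#
  evalZ g ((x , b) ∷ z)  = x * g b + evalZ g z

  evalH : (ℕ → Word → Carrier) → H → Carrier
  evalH f []                  = 0#
  evalH f ((x , k , u) ∷ h)   = x * f k u + evalH f h

  -- Equality in the free modules 𝔷 and 𝔥¹[t]: equal under every
  -- linear functional on the basis.
  _≈Z_ : Z → Z → Set (a ⊔ c ⊔ ℓ)
  z₁ ≈Z z₂ = ∀ (g : A → Carrier) → evalZ g z₁ ≈ evalZ g z₂

  _≈H_ : H → H → Set (a ⊔ c ⊔ ℓ)
  h₁ ≈H h₂ = ∀ (f : ℕ → Word → Carrier) → evalH f h₁ ≈ evalH f h₂

  scaleZ : Carrier → Z → Z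
  scaleZ x = map (λ { (y , b) → (x * y , b) })

  letter : A → Z
  letter b = (1# , b) ∷ []

  _∘Z_ : Z → Z → Z
  z₁ ∘Z z₂ = concatMap (λ { (x , b) → concatMap (λ { (y , b') → scaleZ (x * y) (mul b b') }) z₂ }) z₁

  IsCommAssoc : Set (a ⊔ c ⊔ ℓ)
  IsCommAssoc = (∀ z₁ z₂ → (z₁ ∘Z z₂) ≈Z (z₂ ∘Z z₁))
              × (∀ z₁ z₂ z₃ → ((z₁ ∘Z z₂) ∘Z z₃) ≈Z (z₁ ∘Z (z₂ ∘Z z₃)))

  act : A → H → H
  act b = concatMap step
    where
    step : Carrier × ℕ × Word → H
    step (x , k , [])      = []
    step (x , k , b' ∷ u)  = map (λ { (y , b'') → (x * y , k , b'' ∷ u) }) (mul b b')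

  lmul : A → H → H
  lmul b = map (λ { (x , k , u) → (x , k , b ∷ u) })

  tmul : H → H
  tmul = map (λ { (x , k , u) → (x , suc k , u) })

  St : Word → H
  St []      = (1# , 0 , []) ∷ []
  St (b ∷ w) = lmul b (St w) ++ tmul (act b (St w))

  -- a₁ ∘ ⋯ ∘ a_k ∈ 𝔷 for a nonempty block (empty block gives 0, never used)
  blockProd : Word → Z
  blockProd []            = []
  blockProd (b ∷ [])      = letter b
  blockProd (b ∷ b' ∷ u)  = letter b ∘Z blockProd (b' ∷ u)

  prodZ : List Z → List (Carrier × Word)
  prodZ []       = (1# , []) ∷ []
  prodZ (z ∷ zs) = concatMap (λ { (x , b) → map (λ { (y , u) → (x * y , b ∷ u) }) (prodZ zs) }) z

  Con : List ℕ → Word → List (Carrier × Word)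
  Con r w = prodZ (map blockProd (blocks r w))

  RHS : Word → H
  RHS w = concatMap (λ r → map (λ { (x , u) → (x , σ (length w) r , u) }) (Con r w)) (R (length w))

module Submission where

-- Both sides are compared through their values under an arbitrary coefficient
-- functional f : ℕ → Word → 𝔄 (this is how equality in 𝔥¹[t] is defined).
-- Every r ∈ R_n has the form r = 0 ∷ map suc s with s a sublist of (0,…,n-1);
-- coeff f w s is the f-value of the term t^{σ(r)} Con_r(w), and the right-hand
-- side is the sum of coeff f w over all such s (RHS-expansion).  For a word b w
-- the sublists of (0,…,n) split into those beginning with 0 (b is a block of
-- its own) and the others (b is merged into the first block, costing one t).
-- These are the f-values of b S^t(w) and of t b∘S^t(w) (coeff-split,
-- coeff-merge), matching S^t(bw) = bS^t(w) + t b∘S^t(w) (St-expansion).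
-- Block products in Con_r are right-nested.

open import Defs
open import Data.Product using (_×_; _,_; uncurry)
open import Data.List using (List)
open import Algebra.Bundles using (CommutativeRing)

open import Data.Bool using (Bool; true; false; if_then_else_)
open import Data.Nat using (ℕ; suc; _∸_; _≡ᵇ_; _≤_; z≤n; s≤s)
open import Data.Nat.Properties using (+-∸-assoc; m≤n⇒m≤1+n)
open import Data.List using ([]; _∷_; _++_; map; concatMap; filterᵇ; upTo; length; last; take)
open import Data.List.Properties using (map-∘; map-++; length-map; length-upTo; map-upTo)
open import Data.List.Relation.Unary.All using (All; []; _∷_) renaming (map to All-map)
open import Data.List.Relation.Unary.All.Properties using (++⁺; map⁺)
open import Data.Maybe using (just)
open import Function using (_∘_)
open import Relation.Binary.PropositionalEquality as ≡ using (_≡_)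

lastOf : ℕ → List ℕ → ℕ
lastOf x []       = x
lastOf x (y ∷ ys) = lastOf y ys

last-∷ : ∀ x xs → last (x ∷ xs) ≡ just (lastOf x xs)
last-∷ x []       = ≡.refl
last-∷ x (y ∷ ys) = last-∷ y ys

validR-0∷ : ∀ n rs → validR n (0 ∷ rs) ≡ (lastOf 0 rs ≡ᵇ n)
validR-0∷ n rs rewrite last-∷ 0 rs = ≡.refl

lastOf-map-suc : ∀ x xs → lastOf (suc x) (map suc xs) ≡ suc (lastOf x xs)
lastOf-map-suc x []       = ≡.refl
lastOf-map-suc x (y ∷ ys) = lastOf-map-suc y ys

validR-shift : ∀ n x xs → validR (suc n) (0 ∷ map suc (x ∷ xs)) ≡ validR n (0 ∷ x ∷ xs)
validR-shift n x xs = begin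
  validR (suc n) (0 ∷ map suc (x ∷ xs)) ≡⟨ validR-0∷ (suc n) (map suc (x ∷ xs)) ⟩
  (lastOf (suc x) (map suc xs) ≡ᵇ suc n) ≡⟨ ≡.cong (_≡ᵇ suc n) (lastOf-map-suc x xs) ⟩
  (lastOf x xs ≡ᵇ n)                     ≡⟨ validR-0∷ n (x ∷ xs) ⟨
  validR n (0 ∷ x ∷ xs)                  ∎
  where open ≡.≡-Reasoning

validR-map-suc : ∀ n s → validR n (map suc s) ≡ false
validR-map-suc n []      = ≡.refl
validR-map-suc n (x ∷ s) = ≡.refl

σ-shift : ∀ n rs → σ n (0 ∷ map suc rs) ≡ σ n (0 ∷ rs)
σ-shift n rs = ≡.cong (n ∸_) (length-map suc rs)

σ-grow : ∀ n rs → length rs ≤ n → σ (suc n) (0 ∷ rs) ≡ suc (σ n (0 ∷ rs))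
σ-grow n rs h = +-∸-assoc 1 h

blocks-shift : ∀ {a} {X : Set a} (r : List ℕ) (b : X) w →
               blocks (map suc r) (b ∷ w) ≡ blocks r w
blocks-shift []             b w = ≡.refl
blocks-shift (p ∷ [])       b w = ≡.refl
blocks-shift (p ∷ q ∷ rest) b w = ≡.cong (_ ∷_) (blocks-shift (q ∷ rest) b w)

sublists-map : ∀ {a b} {X : Set a} {Y : Set b} (g : X → Y) xs →
               sublists (map g xs) ≡ map (map g) (sublists xs)
sublists-map g []       = ≡.refl
sublists-map g (x ∷ xs) = begin
  map (g x ∷_) (sublists (map g xs)) ++ sublists (map g xs)
    ≡⟨ ≡.cong (λ S → map (g x ∷_) S ++ S) (sublists-map g xs) ⟩
  map (g x ∷_) (map (map g) (sublists xs)) ++ map (map g) (sublists xs)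
    ≡⟨ ≡.cong (_++ _) (≡.trans (≡.sym (map-∘ (sublists xs))) (map-∘ (sublists xs))) ⟩
  map (map g) (map (x ∷_) (sublists xs)) ++ map (map g) (sublists xs)
    ≡⟨ map-++ (map g) (map (x ∷_) (sublists xs)) (sublists xs) ⟨
  map (map g) (map (x ∷_) (sublists xs) ++ sublists xs) ∎
  where open ≡.≡-Reasoning

sublists-upTo-suc : ∀ n → sublists (upTo (suc n)) ≡
  map ((0 ∷_) ∘ map suc) (sublists (upTo n)) ++ map (map suc) (sublists (upTo n))
sublists-upTo-suc n = begin
  sublists (upTo (suc n))
    ≡⟨ ≡.cong sublists upTo-suc ⟩
  sublists (0 ∷ map suc (upTo n))
    ≡⟨ ≡.cong (λ S → map (0 ∷_) S ++ S) (sublists-map suc (upTo n)) ⟩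
  map (0 ∷_) (map (map suc) S) ++ map (map suc) S
    ≡⟨ ≡.cong (_++ map (map suc) S) (map-∘ {g = 0 ∷_} {f = map suc} S) ⟨
  map ((0 ∷_) ∘ map suc) S ++ map (map suc) S ∎
  where
  open ≡.≡-Reasoning
  S : List (List ℕ)
  S = sublists (upTo n)
  upTo-suc : upTo (suc n) ≡ 0 ∷ map suc (upTo n)
  upTo-suc = ≡.cong (0 ∷_) (≡.sym (map-upTo suc n))

sublists-length : ∀ {a} {X : Set a} (xs : List X) →
                  All (λ s → length s ≤ length xs) (sublists xs)
sublists-length []       = z≤n ∷ []
sublists-length (x ∷ xs) =
  ++⁺ (map⁺ (All-map s≤s (sublists-length xs))) (All-map m≤n⇒m≤1+n (sublists-length xs))

sublists-upTo-length : ∀ n → All (λ s → length s ≤ n) (sublists (upTo n))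
sublists-upTo-length n =
  ≡.subst (λ m → All (λ s → length s ≤ m) (sublists (upTo n))) (length-upTo n) (sublists-length (upTo n))

module LinearCombinations {c ℓ} (𝔄 : CommutativeRing c ℓ) where
  open CommutativeRing 𝔄
  open import Relation.Binary.Reasoning.Setoid setoid
  open import Algebra.Properties.CommutativeSemigroup *-commutativeSemigroup
    using () renaming (x∙yz≈y∙xz to *-swap)
  open import Algebra.Properties.CommutativeSemigroup +-commutativeSemigroup
    using () renaming (interchange to +-interchange)

  ΣL : ∀ {b} {X : Set b} → (X → Carrier) → List X → Carrier
  ΣL F []       = 0#
  ΣL F (x ∷ xs) = F x + ΣL F xs

  ΣL-++ : ∀ {b} {X : Set b} (F : X → Carrier) xs ys → ΣL F (xs ++ ys) ≈ ΣL F xs + ΣL F ys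
  ΣL-++ F []       ys = sym (+-identityˡ _)
  ΣL-++ F (x ∷ xs) ys = trans (+-congˡ (ΣL-++ F xs ys)) (sym (+-assoc _ _ _))

  ΣL-map : ∀ {b d} {X : Set b} {Y : Set d} (F : Y → Carrier) (g : X → Y) xs →
           ΣL F (map g xs) ≡ ΣL (F ∘ g) xs
  ΣL-map F g []       = ≡.refl
  ΣL-map F g (x ∷ xs) = ≡.cong (F (g x) +_) (ΣL-map F g xs)

  ΣL-congᴾ : ∀ {b p} {X : Set b} {P : X → Set p} {F G : X → Carrier} →
             (∀ {x} → P x → F x ≈ G x) → ∀ {xs} → All P xs → ΣL F xs ≈ ΣL G xs
  ΣL-congᴾ h []         = refl
  ΣL-congᴾ h (px ∷ pxs) = +-cong (h px) (ΣL-congᴾ h pxs)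

  ΣL-cong : ∀ {b} {X : Set b} {F G : X → Carrier} → (∀ x → F x ≈ G x) → ∀ xs → ΣL F xs ≈ ΣL G xs
  ΣL-cong h []       = refl
  ΣL-cong h (x ∷ xs) = +-cong (h x) (ΣL-cong h xs)

  ΣL-zero : ∀ {b} {X : Set b} {F : X → Carrier} → (∀ x → F x ≈ 0#) → ∀ xs → ΣL F xs ≈ 0#
  ΣL-zero h xs = trans (ΣL-cong h xs) (zeros xs)
    where
    zeros : ∀ xs → ΣL (λ _ → 0#) xs ≈ 0#
    zeros []       = refl
    zeros (x ∷ xs) = trans (+-identityˡ _) (zeros xs)

  [_]∙_ : Bool → Carrier → Carrier
  [ p ]∙ x = if p then x else 0#

  []∙-cong : ∀ {p q x y} → p ≡ q → x ≈ y → [ p ]∙ x ≈ [ q ]∙ y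
  []∙-cong {true}  ≡.refl h = h
  []∙-cong {false} ≡.refl h = refl

  []∙-zero : ∀ p {x} → x ≈ 0# → [ p ]∙ x ≈ 0#
  []∙-zero true  h = h
  []∙-zero false h = refl

  ΣL-filter : ∀ {b} {X : Set b} (F : X → Carrier) p xs →
              ΣL F (filterᵇ p xs) ≈ ΣL (λ x → [ p x ]∙ F x) xs
  ΣL-filter F p []       = refl
  ΣL-filter F p (x ∷ xs) with p x
  ... | true  = +-congˡ (ΣL-filter F p xs)
  ... | false = trans (ΣL-filter F p xs) (sym (+-identityˡ _))

  lin : ∀ {b} {Y : Set b} → (Y → Carrier) → List (Carrier × Y) → Carrier
  lin φ = ΣL (λ { (x , y) → x * φ y })

  lin-++ : ∀ {b} {Y : Set b} (φ : Y → Carrier) L₁ L₂ → lin φ (L₁ ++ L₂) ≈ lin φ L₁ + lin φ L₂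
  lin-++ φ = ΣL-++ _

  lin-cong : ∀ {b} {Y : Set b} {φ ψ : Y → Carrier} → (∀ y → φ y ≈ ψ y) → ∀ L → lin φ L ≈ lin ψ L
  lin-cong h = ΣL-cong (λ { (x , y) → *-congˡ (h y) })

  lin-concatMap : ∀ {b d} {X : Set b} {Y : Set d} (φ : Y → Carrier) (F : X → List (Carrier × Y)) xs →
                  lin φ (concatMap F xs) ≈ ΣL (lin φ ∘ F) xs
  lin-concatMap φ F []       = refl
  lin-concatMap φ F (x ∷ xs) = trans (lin-++ φ (F x) (concatMap F xs)) (+-congˡ (lin-concatMap φ F xs))

  lin-relabel : ∀ {b d} {Y : Set b} {Y' : Set d} (φ : Y' → Carrier) (g : Y → Y') L →
                lin φ (map (λ { (x , y) → (x , g y) }) L) ≡ lin (φ ∘ g) L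
  lin-relabel φ g = ΣL-map _ _

  lin-scale : ∀ {b d} {Y : Set b} {Y' : Set d} (φ : Y' → Carrier) x (g : Y → Y') L →
              lin φ (map (λ { (y , u) → (x * y , g u) }) L) ≈ x * lin (φ ∘ g) L
  lin-scale φ x g []            = sym (zeroʳ x)
  lin-scale φ x g ((y , u) ∷ L) =
    trans (+-cong (*-assoc x y _) (lin-scale φ x g L)) (sym (distribˡ x _ _))

  lin-zeroᶠ : ∀ {b} {Y : Set b} (L : List (Carrier × Y)) → lin (λ _ → 0#) L ≈ 0#
  lin-zeroᶠ = ΣL-zero (λ { (x , _) → zeroʳ x })

  lin-+ᶠ : ∀ {b} {Y : Set b} (φ ψ : Y → Carrier) L → lin (λ y → φ y + ψ y) L ≈ lin φ L + lin ψ L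
  lin-+ᶠ φ ψ []            = sym (+-identityˡ _)
  lin-+ᶠ φ ψ ((x , y) ∷ L) =
    trans (+-cong (distribˡ x (φ y) (ψ y)) (lin-+ᶠ φ ψ L)) (+-interchange _ _ _ _)

  lin-*ᶠ : ∀ {b} {Y : Set b} z (φ : Y → Carrier) L → lin (λ y → z * φ y) L ≈ z * lin φ L
  lin-*ᶠ z φ []            = sym (zeroʳ z)
  lin-*ᶠ z φ ((x , y) ∷ L) = trans (+-cong (*-swap x z (φ y)) (lin-*ᶠ z φ L)) (sym (distribˡ z _ _))

  lin-swap : ∀ {b d} {Y : Set b} {Y' : Set d} (ψ : Y → Y' → Carrier) M P →
             lin (λ y → lin (ψ y) P) M ≈ lin (λ u → lin (λ y → ψ y u) M) P
  lin-swap ψ M []            = lin-zeroᶠ M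
  lin-swap ψ M ((x , u) ∷ P) = begin
    lin (λ y → x * ψ y u + lin (ψ y) P) M
      ≈⟨ lin-+ᶠ _ _ M ⟩
    lin (λ y → x * ψ y u) M + lin (λ y → lin (ψ y) P) M
      ≈⟨ +-cong (lin-*ᶠ x (λ y → ψ y u) M) (lin-swap ψ M P) ⟩
    x * lin (λ y → ψ y u) M + lin (λ v → lin (λ y → ψ y v) M) P ∎

module Expansion {c ℓ a} (𝔄 : CommutativeRing c ℓ) (A : Set a)
                 (mul : A → A → List (CommutativeRing.Carrier 𝔄 × A)) where
  open CommutativeRing 𝔄
  open Setting 𝔄 A mul
  open LinearCombinations 𝔄
  open import Relation.Binary.Reasoning.Setoid setoid

  evalH-lin : ∀ f h → evalH f h ≡ lin (uncurry f) h
  evalH-lin f []                = ≡.refl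
  evalH-lin f ((x , k , u) ∷ h) = ≡.cong (x * f k u +_) (evalH-lin f h)

  -- The transpose of the action of the letter b: (b ⋆ φ)(u) = φ(b ∘ u).
  _⋆_ : A → (Word → Carrier) → Word → Carrier
  (b ⋆ φ) []       = 0#
  (b ⋆ φ) (b' ∷ u) = lin (λ b'' → φ (b'' ∷ u)) (mul b b')

  lin-act : ∀ f b h → lin (uncurry f) (act b h) ≈ lin (uncurry (λ k → b ⋆ f k)) h
  lin-act f b []                     = refl
  lin-act f b ((x , k , []) ∷ h)     = trans (lin-act f b h) (sym (trans (+-congʳ (zeroʳ x)) (+-identityˡ _)))
  lin-act f b ((x , k , b' ∷ u) ∷ h) = trans (lin-++ (uncurry f) (map _ (mul b b')) (act b h))
    (+-cong (lin-scale (uncurry f) x (λ b'' → (k , b'' ∷ u)) (mul b b')) (lin-act f b h))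

  St-step : ∀ f b w → evalH f (St (b ∷ w)) ≈
    evalH (λ k u → f k (b ∷ u)) (St w) + evalH (λ k → b ⋆ f (suc k)) (St w)
  St-step f b w = begin
    evalH f (lmul b (St w) ++ tmul (act b (St w)))
      ≡⟨ evalH-lin f (lmul b (St w) ++ tmul (act b (St w))) ⟩
    lin (uncurry f) (lmul b (St w) ++ tmul (act b (St w)))
      ≈⟨ lin-++ (uncurry f) (lmul b (St w)) _ ⟩
    lin (uncurry f) (lmul b (St w)) + lin (uncurry f) (tmul (act b (St w)))
      ≡⟨ ≡.cong₂ _+_ (lin-relabel _ (λ { (k , u) → (k , b ∷ u) }) (St w))
                      (lin-relabel _ (λ { (k , u) → (suc k , u) }) (act b (St w))) ⟩
    lin (uncurry (λ k u → f k (b ∷ u))) (St w) + lin (uncurry (f ∘ suc)) (act b (St w))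
      ≈⟨ +-congˡ (lin-act (f ∘ suc) b (St w)) ⟩
    lin (uncurry (λ k u → f k (b ∷ u))) (St w) + lin (uncurry (λ k → b ⋆ f (suc k))) (St w)
      ≡⟨ ≡.cong₂ _+_ (evalH-lin _ (St w)) (evalH-lin _ (St w)) ⟨
    evalH (λ k u → f k (b ∷ u)) (St w) + evalH (λ k → b ⋆ f (suc k)) (St w) ∎

  lin-prodZ-∷ : ∀ φ z zs → lin φ (prodZ (z ∷ zs)) ≈ lin (λ b → lin (φ ∘ (b ∷_)) (prodZ zs)) z
  lin-prodZ-∷ φ z zs = trans (lin-concatMap φ _ z) (ΣL-cong (λ { (x , b) → lin-scale φ x (b ∷_) (prodZ zs) }) z)

  lin-letter-∘ : ∀ g b z → lin g (letter b ∘Z z) ≈ lin (λ b' → lin g (mul b b')) z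
  lin-letter-∘ g b z = begin
    lin g (concatMap (λ { (y , b') → scaleZ (1# * y) (mul b b') }) z ++ [])
      ≈⟨ trans (lin-++ g (concatMap _ z) []) (+-identityʳ _) ⟩
    lin g (concatMap (λ { (y , b') → scaleZ (1# * y) (mul b b') }) z)
      ≈⟨ lin-concatMap g _ z ⟩
    ΣL (λ { (y , b') → lin g (scaleZ (1# * y) (mul b b')) }) z
      ≈⟨ ΣL-cong (λ { (y , b') → trans (lin-scale g (1# * y) (λ b'' → b'') (mul b b'))
                                       (*-congʳ (*-identityˡ y)) }) z ⟩
    lin (λ b' → lin g (mul b b')) z ∎

  lin-act-first : ∀ φ b z zs → lin φ (prodZ ((letter b ∘Z z) ∷ zs)) ≈ lin (b ⋆ φ) (prodZ (z ∷ zs))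
  lin-act-first φ b z zs = begin
    lin φ (prodZ ((letter b ∘Z z) ∷ zs))                   ≈⟨ lin-prodZ-∷ φ (letter b ∘Z z) zs ⟩
    lin G (letter b ∘Z z)                                  ≈⟨ lin-letter-∘ G b z ⟩
    lin (λ b' → lin G (mul b b')) z                        ≈⟨ lin-cong (λ b' → lin-swap (λ c u → φ (c ∷ u)) (mul b b') P) z ⟩
    lin (λ b' → lin ((b ⋆ φ) ∘ (b' ∷_)) P) z               ≈⟨ lin-prodZ-∷ (b ⋆ φ) z zs ⟨
    lin (b ⋆ φ) (prodZ (z ∷ zs))                           ∎
    where
    P : List (Carrier × Word)
    P = prodZ zs
    G : A → Carrier
    G c = lin (φ ∘ (c ∷_)) P

  lin-Con-split : ∀ φ b w rs →
    lin φ (Con (0 ∷ map suc (0 ∷ rs)) (b ∷ w)) ≈ lin (φ ∘ (b ∷_)) (Con (0 ∷ rs) w)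
  lin-Con-split φ b w rs = begin
    lin φ (prodZ (letter b ∷ map blockProd (blocks (map suc (0 ∷ rs)) (b ∷ w))))
      ≈⟨ trans (lin-prodZ-∷ φ (letter b) (map blockProd (blocks (map suc (0 ∷ rs)) (b ∷ w)))) (trans (+-identityʳ _) (*-identityˡ _)) ⟩
    lin (φ ∘ (b ∷_)) (prodZ (map blockProd (blocks (map suc (0 ∷ rs)) (b ∷ w))))
      ≡⟨ ≡.cong (lin (φ ∘ (b ∷_)) ∘ prodZ ∘ map blockProd) (blocks-shift (0 ∷ rs) b w) ⟩
    lin (φ ∘ (b ∷_)) (Con (0 ∷ rs) w) ∎

  lin-Con-merge : ∀ φ b c w x rs →
    lin φ (Con (0 ∷ map suc (suc x ∷ rs)) (b ∷ c ∷ w)) ≈ lin (b ⋆ φ) (Con (0 ∷ suc x ∷ rs) (c ∷ w))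
  lin-Con-merge φ b c w x rs = begin
    lin φ (prodZ ((letter b ∘Z first) ∷ map blockProd (blocks (map suc (suc x ∷ rs)) (b ∷ c ∷ w))))
      ≡⟨ ≡.cong (λ B → lin φ (prodZ ((letter b ∘Z first) ∷ map blockProd B))) (blocks-shift (suc x ∷ rs) b (c ∷ w)) ⟩
    lin φ (prodZ ((letter b ∘Z first) ∷ map blockProd (blocks (suc x ∷ rs) (c ∷ w))))
      ≈⟨ lin-act-first φ b first (map blockProd (blocks (suc x ∷ rs) (c ∷ w))) ⟩
    lin (b ⋆ φ) (Con (0 ∷ suc x ∷ rs) (c ∷ w)) ∎
    where
    first : Z
    first = blockProd (c ∷ take x w)

  -- The f-value of the term t^{σ(r)} Con_r(w) of the right-hand side
  -- (0 unless r ∈ R_n), and its version indexed by r = 0 ∷ map suc s.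
  termR : (ℕ → Word → Carrier) → Word → List ℕ → Carrier
  termR f w r = [ validR (length w) r ]∙ lin (f (σ (length w) r)) (Con r w)

  coeff : (ℕ → Word → Carrier) → Word → List ℕ → Carrier
  coeff f w s = termR f w (0 ∷ map suc s)

  coeff-split : ∀ f b w s → coeff f (b ∷ w) (0 ∷ map suc s) ≈ coeff (λ k u → f k (b ∷ u)) w s
  coeff-split f b w s =
    []∙-cong (validR-shift (length w) 0 (map suc s)) (begin
      lin (f (σ (suc (length w)) r)) (Con r (b ∷ w))
        ≡⟨ ≡.cong (λ k → lin (f k) (Con r (b ∷ w))) (σ-shift (suc (length w)) (0 ∷ map suc s)) ⟩
      lin (f k) (Con r (b ∷ w))
        ≈⟨ lin-Con-split (f k) b w (map suc s) ⟩
      lin (λ u → f k (b ∷ u)) (Con (0 ∷ map suc s) w) ∎)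
    where
    r : List ℕ
    r = 0 ∷ map suc (0 ∷ map suc s)
    k : ℕ
    k = σ (length w) (0 ∷ map suc s)

  coeff-merge : ∀ f b w s → length s ≤ length w →
    coeff f (b ∷ w) (map suc s) ≈ coeff (λ k → b ⋆ f (suc k)) w s
  coeff-merge f b w       []      _       =
    sym ([]∙-zero (validR (length w) (0 ∷ [])) (trans (+-identityʳ _) (zeroʳ _)))
  coeff-merge f b (c ∷ w) (x ∷ t) (s≤s h) =
    []∙-cong (validR-shift (suc (length w)) (suc x) (map suc t)) (begin
      lin (f (σ (suc (suc (length w))) r)) (Con r (b ∷ c ∷ w))
        ≡⟨ ≡.cong (λ k → lin (f k) (Con r (b ∷ c ∷ w))) σ-eq ⟩
      lin (f (suc k)) (Con r (b ∷ c ∷ w))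
        ≈⟨ lin-Con-merge (f (suc k)) b c w x (map suc t) ⟩
      lin (b ⋆ f (suc k)) (Con (0 ∷ map suc (x ∷ t)) (c ∷ w)) ∎)
    where
    r : List ℕ
    r = 0 ∷ map suc (map suc (x ∷ t))
    k : ℕ
    k = σ (suc (length w)) (0 ∷ map suc (x ∷ t))
    t-fits : length (map suc t) ≤ length w
    t-fits = ≡.subst (_≤ length w) (≡.sym (length-map suc t)) h
    σ-eq : σ (suc (suc (length w))) r ≡ suc k
    σ-eq = ≡.trans (σ-shift (suc (suc (length w))) (map suc (x ∷ t)))
                   (σ-grow (suc (length w)) (map suc (x ∷ t)) (s≤s t-fits))

  ΣL-sublists-upTo-suc : ∀ (F : List ℕ → Carrier) n → ΣL F (sublists (upTo (suc n))) ≈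
    ΣL (F ∘ (0 ∷_) ∘ map suc) (sublists (upTo n)) + ΣL (F ∘ map suc) (sublists (upTo n))
  ΣL-sublists-upTo-suc F n = begin
    ΣL F (sublists (upTo (suc n)))
      ≡⟨ ≡.cong (ΣL F) (sublists-upTo-suc n) ⟩
    ΣL F (map ((0 ∷_) ∘ map suc) S ++ map (map suc) S)
      ≈⟨ ΣL-++ F (map ((0 ∷_) ∘ map suc) S) (map (map suc) S) ⟩
    ΣL F (map ((0 ∷_) ∘ map suc) S) + ΣL F (map (map suc) S)
      ≡⟨ ≡.cong₂ _+_ (ΣL-map F _ S) (ΣL-map F _ S) ⟩
    ΣL (F ∘ (0 ∷_) ∘ map suc) S + ΣL (F ∘ map suc) S ∎
    where
    S : List (List ℕ)
    S = sublists (upTo n)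

  St-expansion : ∀ w f → evalH f (St w) ≈ ΣL (coeff f w) (sublists (upTo (length w)))
  St-expansion []      f = sym (+-identityʳ _)
  St-expansion (b ∷ w) f = begin
    evalH f (St (b ∷ w))
      ≈⟨ St-step f b w ⟩
    evalH fsplit (St w) + evalH fmerge (St w)
      ≈⟨ +-cong (St-expansion w fsplit) (St-expansion w fmerge) ⟩
    ΣL (coeff fsplit w) S + ΣL (coeff fmerge w) S
      ≈⟨ +-cong (ΣL-cong (coeff-split f b w) S)
                (ΣL-congᴾ (λ {s} → coeff-merge f b w s) (sublists-upTo-length (length w))) ⟨
    ΣL (coeff f (b ∷ w) ∘ (0 ∷_) ∘ map suc) S + ΣL (coeff f (b ∷ w) ∘ map suc) S
      ≈⟨ ΣL-sublists-upTo-suc (coeff f (b ∷ w)) (length w) ⟨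
    ΣL (coeff f (b ∷ w)) (sublists (upTo (length (b ∷ w)))) ∎
    where
    S : List (List ℕ)
    S = sublists (upTo (length w))
    fsplit fmerge : ℕ → Word → Carrier
    fsplit k u = f k (b ∷ u)
    fmerge k   = b ⋆ f (suc k)

  -- Right-hand side: only candidates starting with 0 survive the filter.
  RHS-expansion : ∀ w f → evalH f (RHS w) ≈ ΣL (coeff f w) (sublists (upTo (length w)))
  RHS-expansion w f = begin
    evalH f (RHS w)
      ≡⟨ evalH-lin f (RHS w) ⟩
    lin (uncurry f) (RHS w)
      ≈⟨ lin-concatMap (uncurry f) _ (R n) ⟩
    ΣL (λ r → lin (uncurry f) (map (λ { (x , u) → (x , σ n r , u) }) (Con r w))) (R n)
      ≈⟨ ΣL-cong (λ r → reflexive (lin-relabel (uncurry f) (σ n r ,_) (Con r w))) (R n) ⟩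
    ΣL (λ r → lin (f (σ n r)) (Con r w)) (R n)
      ≈⟨ ΣL-filter _ (validR n) (sublists (upTo (suc n))) ⟩
    ΣL (termR f w) (sublists (upTo (suc n)))
      ≈⟨ ΣL-sublists-upTo-suc (termR f w) n ⟩
    ΣL (coeff f w) S + ΣL (termR f w ∘ map suc) S
      ≈⟨ +-congˡ (ΣL-zero (λ s → reflexive (≡.cong (λ p → [ p ]∙ lin (f (σ n (map suc s))) (Con (map suc s) w)) (validR-map-suc n s))) S) ⟩
    ΣL (coeff f w) S + 0#
      ≈⟨ +-identityʳ _ ⟩
    ΣL (coeff f w) S ∎
    where
    n : ℕ
    n = length w
    S : List (List ℕ)
    S = sublists (upTo n)

proposition3p3 : ∀ {c ℓ a} (𝔄 : CommutativeRing c ℓ) → IsℚAlgebra 𝔄 →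
    (A : Set a) (mul : A → A → List (CommutativeRing.Carrier 𝔄 × A)) →
    Setting.IsCommAssoc 𝔄 A mul →
    ∀ (w : List A) → Setting._≈H_ 𝔄 A mul (Setting.St 𝔄 A mul w) (Setting.RHS 𝔄 A mul w)
proposition3p3 𝔄 _ A mul _ w f =
  trans (St-expansion w f) (sym (RHS-expansion w f))
  where
  open CommutativeRing 𝔄 using (trans; sym)
  open Expansion 𝔄 A mul using (St-expansion; RHS-expansion)
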